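{- For any positive integers $k,n$ with $k\le n$, $$\frac{n(n+1)(n+2)}{(2,n)}\ \Big|\ (n+k+1)\binom{n+k}{k}\binom{n+1}{k+1}\binom{2k}{k+1}.$$
   Context: $(2,n)$ denotes $\gcd(2,n)$. -}

module Defs where

open import Data.Nat using (ℕ; NonZero; ≢-nonZero)
open import Data.Nat.GCD using (gcd; gcd[m,n]≢0)
open import Data.Sum using (inj₁)

gcd2-nonZero : ∀ (n : ℕ) → NonZero (gcd 2 n)
gcd2-nonZero n = ≢-nonZero (gcd[m,n]≢0 2 n (inj₁ (λ ())))

module Submission where

-- Write P = X * C(2k,k+1) with X = (n+k+1) C(n+k,k) C(n+1,k+1).
-- Two elementary ratio identities between neighbouring binomial coefficients,
--   absorption:  (j+1) C(m+1,j+1) = (m+1) C(m,j),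
--   neighbour :  (a+1) C(m,a+1)   = (m-a) C(m,a),
-- are proved by clearing denominators with the factorial formula for C.
-- From them: k divides C(2k,k+1) (since (k+1) C(2k,k+1) = k C(2k,k) and k, k+1
-- are coprime), so X k divides P; moreover (n+1)(n+2) and n(n+1) both divide X k,
-- since repeated absorption/neighbour steps rewrite X k as (n+1)(n+2) times a
-- binomial coefficient, resp. as n(n+1) times a product of binomial coefficients.
-- Finally, if (n+1)(n+2) and n(n+1) divide P, then n(n+1)(n+2) divides
-- gcd(n,n+2) P = gcd(2,n) P, via lcm(n,n+2) gcd(n,n+2) = n(n+2); dividing by
-- gcd(2,n) gives the theorem.

open import Defs
open import Data.Nat using (ℕ; _+_; _*_; _≤_; _/_)
open import Data.Nat.GCD using (gcd)
open import Data.Nat.Divisibility using (_∣_)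
open import Data.Nat.Combinatorics using (_C_)

open import Data.Nat using (zero; suc; _!; _∸_; NonZero; ≢-nonZero)
open import Data.Nat.Properties
open import Data.Nat.DivMod using (m/n*n≡m; m*[n/m]≡n)
open import Data.Nat.Divisibility
  using (divides; _∣0; ∣-trans; m∣m*n; *-monoʳ-∣; *-monoˡ-∣; *-cancelˡ-∣; *-cancelʳ-∣; ∣m∣n⇒∣m+n; ∣m+n∣m⇒∣n)
open import Data.Nat.GCD using (gcd[m,n]∣m; gcd[m,n]∣n; gcd-greatest; gcd-universality)
open import Data.Nat.LCM using (lcm-least; gcd*lcm)
open import Data.Nat.Coprimality using (Coprime; coprime-divisor; coprime-+; 1-coprimeTo)
import Data.Nat.Coprimality as Coprimality
open import Data.Nat.Combinatorics using (k![n∸k]!∣n!)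
open import Data.Nat.Combinatorics.Specification using (nCk≡n!/k![n-k]!)
open import Data.Nat.Tactic.RingSolver using (solve-∀)
open import Data.Product using (_×_; _,_)
open import Relation.Binary.PropositionalEquality
open ≡-Reasoning

choose*factorials : ∀ {m} a b → a + b ≡ m → (m C a) * (a ! * b !) ≡ m !
choose*factorials a b refl
  with a + b ∸ a | m+n∸m≡n a b | nCk≡n!/k![n-k]! (m≤m+n a b) | k![n∸k]!∣n! (m≤m+n a b)
... | _ | refl | binomial-formula | denominator-divides =
  trans (cong (_* (a ! * b !)) binomial-formula) (m/n*n≡m {{a !* b !≢0}} denominator-divides)

scale-into-product : ∀ x c f g → x * c * (f * g) ≡ c * (x * f * g)
scale-into-product = solve-∀

absorption : ∀ {m} j b → j + b ≡ m → suc j * (suc m C suc j) ≡ suc m * (m C j)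
absorption {m} j b refl = *-cancelʳ-≡ _ _ (j ! * b !) {{j !* b !≢0}} (begin
  suc j * (suc m C suc j) * (j ! * b !)  ≡⟨ scale-into-product (suc j) (suc m C suc j) (j !) (b !) ⟩
  (suc m C suc j) * (suc j ! * b !)      ≡⟨ choose*factorials (suc j) b refl ⟩
  suc m !                                ≡⟨ cong (suc m *_) (choose*factorials j b refl) ⟨
  suc m * ((m C j) * (j ! * b !))        ≡⟨ *-assoc (suc m) (m C j) (j ! * b !) ⟨
  suc m * (m C j) * (j ! * b !)          ∎)

neighbour : ∀ {m} a b → a + suc b ≡ m → suc a * (m C suc a) ≡ suc b * (m C a)
neighbour {m} a b refl = *-cancelʳ-≡ _ _ (a ! * b !) {{a !* b !≢0}} (begin
  suc a * (m C suc a) * (a ! * b !)  ≡⟨ scale-into-product (suc a) (m C suc a) (a !) (b !) ⟩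
  (m C suc a) * (suc a ! * b !)      ≡⟨ choose*factorials (suc a) b (sym (+-suc a b)) ⟩
  m !                                ≡⟨ choose*factorials a (suc b) refl ⟨
  (m C a) * (a ! * suc b !)          ≡⟨ scale-into-second (suc b) (m C a) (a !) (b !) ⟨
  suc b * (m C a) * (a ! * b !)      ∎)
  where
  scale-into-second : ∀ x c f g → x * c * (f * g) ≡ c * (f * (x * g))
  scale-into-second = solve-∀

consecutive-coprime : ∀ k → Coprime k (k + 1)
consecutive-coprime k = Coprimality.sym (coprime-+ (1-coprimeTo k))

k∣[2k]C[k+1] : ∀ k → k ∣ (2 * k) C (k + 1)
k∣[2k]C[k+1] zero = 0 ∣0
k∣[2k]C[k+1] k@(suc s) = coprime-divisor (consecutive-coprime k) (divides ((2 * k) C k) shift)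
  where
  shift : (k + 1) * ((2 * k) C (k + 1)) ≡ ((2 * k) C k) * k
  shift = begin
    (k + 1) * ((2 * k) C (k + 1))  ≡⟨ cong (λ j → j * ((2 * k) C j)) (+-comm k 1) ⟩
    suc k * ((2 * k) C suc k)      ≡⟨ neighbour k s (cong (k +_) (sym (+-identityʳ k))) ⟩
    k * ((2 * k) C k)              ≡⟨ *-comm k ((2 * k) C k) ⟩
    ((2 * k) C k) * k              ∎

-- Absorption in the shape it occurs in the theorem:
-- (n+k+1) C(n+k,k) = (k+1) C(n+k+1,k+1).
scaled-choose : ∀ n k → (n + k + 1) * ((n + k) C k) ≡ (k + 1) * ((n + k + 1) C (k + 1))
scaled-choose n k = begin
  (n + k + 1) * ((n + k) C k)        ≡⟨ cong (_* ((n + k) C k)) (+-comm (n + k) 1) ⟩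
  suc (n + k) * ((n + k) C k)        ≡⟨ absorption k n (+-comm k n) ⟨
  suc k * (suc (n + k) C suc k)      ≡⟨ cong₂ (λ j m → j * (m C j)) (+-comm 1 k) (+-comm 1 (n + k)) ⟩
  (k + 1) * ((n + k + 1) C (k + 1))  ∎

upper-divides : ∀ n k → (n + 1) * (n + 2) ∣ (n + k + 1) * ((n + k) C k) * k
upper-divides n zero = divides 0 (*-zeroʳ ((n + 0 + 1) * ((n + 0) C 0)))
upper-divides n k@(suc s) = subst ((n + 1) * (n + 2) ∣_) (sym chain) (m∣m*n (M C s))
  where
  M : ℕ
  M = n + k + 1
  k+[n+1]≡n+k+1 : ∀ n k → k + suc n ≡ n + k + 1
  k+[n+1]≡n+k+1 = solve-∀
  s+[n+2]≡n+k+1 : ∀ n s → s + suc (suc n) ≡ n + suc s + 1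
  s+[n+2]≡n+k+1 = solve-∀
  first-step : (k + 1) * (M C (k + 1)) ≡ (n + 1) * (M C k)
  first-step = begin
    (k + 1) * (M C (k + 1))  ≡⟨ cong (λ j → j * (M C j)) (+-comm k 1) ⟩
    suc k * (M C suc k)      ≡⟨ neighbour k n (k+[n+1]≡n+k+1 n k) ⟩
    suc n * (M C k)          ≡⟨ cong (_* (M C k)) (+-comm 1 n) ⟩
    (n + 1) * (M C k)        ∎
  second-step : (M C k) * k ≡ (n + 2) * (M C s)
  second-step = begin
    (M C k) * k                ≡⟨ *-comm (M C k) k ⟩
    k * (M C k)                ≡⟨ neighbour s (suc n) (s+[n+2]≡n+k+1 n s) ⟩
    suc (suc n) * (M C s)      ≡⟨ cong (_* (M C s)) (+-comm 2 n) ⟩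
    (n + 2) * (M C s)          ∎
  chain : (n + k + 1) * ((n + k) C k) * k ≡ (n + 1) * (n + 2) * (M C s)
  chain = begin
    (n + k + 1) * ((n + k) C k) * k  ≡⟨ cong (_* k) (scaled-choose n k) ⟩
    (k + 1) * (M C (k + 1)) * k      ≡⟨ cong (_* k) first-step ⟩
    (n + 1) * (M C k) * k            ≡⟨ *-assoc (n + 1) (M C k) k ⟩
    (n + 1) * ((M C k) * k)          ≡⟨ cong ((n + 1) *_) second-step ⟩
    (n + 1) * ((n + 2) * (M C s))    ≡⟨ *-assoc (n + 1) (n + 2) (M C s) ⟨
    (n + 1) * (n + 2) * (M C s)      ∎

lower-divides : ∀ n k → k ≤ n →
  n * (n + 1) ∣ (n + k + 1) * ((n + k) C k) * ((n + 1) C (k + 1)) * k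
lower-divides n zero _ = divides 0 (*-zeroʳ ((n + 0 + 1) * ((n + 0) C 0) * ((n + 1) C (0 + 1))))
lower-divides n k@(suc s) k≤n with m≤n⇒∃[o]m+o≡n k≤n
... | d , refl = subst (n * (n + 1) ∣_) (sym chain) (m∣m*n (c₁ * c₄))
  where
  c₁ : ℕ
  c₁ = (n + k + 1) C (k + 1)
  c₂ : ℕ
  c₂ = (n + 1) C (k + 1)
  c₃ : ℕ
  c₃ = n C k
  c₄ : ℕ
  c₄ = (s + d) C s
  first-step : (k + 1) * c₂ ≡ (n + 1) * c₃
  first-step = begin
    (k + 1) * ((n + 1) C (k + 1))  ≡⟨ cong₂ (λ j m → j * (m C j)) (+-comm k 1) (+-comm n 1) ⟩
    suc k * (suc n C suc k)        ≡⟨ absorption k d refl ⟩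
    suc n * (n C k)                ≡⟨ cong (_* c₃) (+-comm 1 n) ⟩
    (n + 1) * (n C k)              ∎
  second-step : c₃ * k ≡ n * c₄
  second-step = trans (*-comm c₃ k) (absorption s d refl)
  regroup₁ : ∀ x a b y → x * a * b * y ≡ a * (x * b) * y
  regroup₁ = solve-∀
  regroup₂ : ∀ a x b y → a * (x * b) * y ≡ x * a * (b * y)
  regroup₂ = solve-∀
  regroup₃ : ∀ x a n c → x * a * (n * c) ≡ n * x * (a * c)
  regroup₃ = solve-∀
  chain : (n + k + 1) * ((n + k) C k) * c₂ * k ≡ n * (n + 1) * (c₁ * c₄)
  chain = begin
    (n + k + 1) * ((n + k) C k) * c₂ * k  ≡⟨ cong (λ x → x * c₂ * k) (scaled-choose n k) ⟩
    (k + 1) * c₁ * c₂ * k                 ≡⟨ regroup₁ (k + 1) c₁ c₂ k ⟩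
    c₁ * ((k + 1) * c₂) * k               ≡⟨ cong (λ x → c₁ * x * k) first-step ⟩
    c₁ * ((n + 1) * c₃) * k               ≡⟨ regroup₂ c₁ (n + 1) c₃ k ⟩
    (n + 1) * c₁ * (c₃ * k)               ≡⟨ cong ((n + 1) * c₁ *_) second-step ⟩
    (n + 1) * c₁ * (n * c₄)               ≡⟨ regroup₃ (n + 1) c₁ n c₄ ⟩
    n * (n + 1) * (c₁ * c₄)               ∎

product∣gcd*common-multiple : ∀ {a b Q} → a ∣ Q → b ∣ Q → a * b ∣ gcd a b * Q
product∣gcd*common-multiple {a} {b} {Q} a∣Q b∣Q =
  subst (_∣ gcd a b * Q) (gcd*lcm a b) (*-monoʳ-∣ (gcd a b) (lcm-least a∣Q b∣Q))

gcd[n,n+2]≡gcd[2,n] : ∀ n → gcd n (n + 2) ≡ gcd 2 n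
gcd[n,n+2]≡gcd[2,n] n = gcd-universality common⇒divides divides⇒common
  where
  common⇒divides : ∀ {d} → d ∣ 2 × d ∣ n → d ∣ gcd n (n + 2)
  common⇒divides (d∣2 , d∣n) = gcd-greatest d∣n (∣m∣n⇒∣m+n d∣n d∣2)
  divides⇒common : ∀ {d} → d ∣ gcd n (n + 2) → d ∣ 2 × d ∣ n
  divides⇒common d∣g = ∣m+n∣m⇒∣n (∣-trans d∣g (gcd[m,n]∣n n (n + 2))) d∣n , d∣n
    where d∣n = ∣-trans d∣g (gcd[m,n]∣m n (n + 2))

consecutive-product∣ : ∀ n P → (n + 1) * (n + 2) ∣ P → n * (n + 1) ∣ P →
  n * (n + 1) * (n + 2) ∣ gcd 2 n * P
consecutive-product∣ n P upper lower with ∣-trans (m∣m*n {n + 1} (n + 2)) upper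
... | divides Q refl = subst₂ _∣_ (swap-last n (n + 1) (n + 2)) (*-assoc (gcd 2 n) Q (n + 1))
        (*-monoˡ-∣ (n + 1) n[n+2]∣gQ)
  where
  instance
    n+1≢0 : NonZero (n + 1)
    n+1≢0 = ≢-nonZero (m+1+n≢0 n)
  n+2∣Q : n + 2 ∣ Q
  n+2∣Q = *-cancelʳ-∣ (n + 1) (subst (_∣ Q * (n + 1)) (*-comm (n + 1) (n + 2)) upper)
  n∣Q : n ∣ Q
  n∣Q = *-cancelʳ-∣ (n + 1) lower
  n[n+2]∣gQ : n * (n + 2) ∣ gcd 2 n * Q
  n[n+2]∣gQ = subst (λ g → n * (n + 2) ∣ g * Q) (gcd[n,n+2]≡gcd[2,n] n)
                (product∣gcd*common-multiple n∣Q n+2∣Q)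
  swap-last : ∀ a b c → a * c * b ≡ a * b * c
  swap-last = solve-∀

quotient∣ : ∀ {g x P} .{{_ : NonZero g}} → g ∣ x → x ∣ g * P → x / g ∣ P
quotient∣ {g} {x} {P} g∣x x∣gP = *-cancelˡ-∣ g (subst (_∣ g * P) (sym (m*[n/m]≡n g∣x)) x∣gP)

lemma4p2 : ∀ (k n : ℕ) → 1 ≤ k → k ≤ n →
    _/_ (n * (n + 1) * (n + 2)) (gcd 2 n) {{gcd2-nonZero n}} ∣
      (n + k + 1) * ((n + k) C k) * ((n + 1) C (k + 1)) * ((2 * k) C (k + 1))
lemma4p2 k n _ k≤n =
  quotient∣ {{gcd2-nonZero n}} gcd∣product
    (consecutive-product∣ n P (∣-trans (upper-divides n k) (∣-trans Ak∣Xk Xk∣P))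
                              (∣-trans (lower-divides n k k≤n) Xk∣P))
  where
  A : ℕ
  A = (n + k + 1) * ((n + k) C k)
  X : ℕ
  X = A * ((n + 1) C (k + 1))
  P : ℕ
  P = X * ((2 * k) C (k + 1))
  Ak∣Xk : A * k ∣ X * k
  Ak∣Xk = *-monoˡ-∣ k (m∣m*n {A} ((n + 1) C (k + 1)))
  Xk∣P : X * k ∣ P
  Xk∣P = *-monoʳ-∣ X (k∣[2k]C[k+1] k)
  gcd∣product : gcd 2 n ∣ n * (n + 1) * (n + 2)
  gcd∣product = ∣-trans (gcd[m,n]∣n 2 n) (∣-trans (m∣m*n (n + 1)) (m∣m*n (n + 2)))
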